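{- The function $\epsilon$ described in the context is well-defined according to the decomposition $\mathcal C=\mathcal C_{\mathrm{sup}}\sqcup\mathcal C_{\mathrm{free}}\sqcup\mathcal C_{\mathrm{inf}}$ and $c_\infty$ (i.e. satisfies conditions (1)--(7) below), and the functions $\delta$ and $\gamma$ described in the context provide the witnesses required in conditions (2)--(6): $\epsilon(c,\delta(c))=0$ for $c\in\mathcal C_{\mathrm{sup}}$; $\epsilon(\delta(c),c)=0$ for $c\in\mathcal C_{\mathrm{inf}}$; $\epsilon(c,\gamma(c,c'))=\epsilon(\gamma(c,c'),c')=0$ for $(c,c')\in\mathcal C_{\mathrm{sup}}\times\mathcal C_{\mathrm{inf}}$ with $\epsilon(c,c')=0$; $\epsilon(c,\gamma(c,c'))=0$ and $\epsilon(\gamma(c,c'),c')=1$ for $c,c'\in\mathcal C_{\mathrm{sup}}$ with $\epsilon(c,c')\in\{0,1\}$; $\epsilon(c,\gamma(c,c'))=1$ and $\epsilon(\gamma(c,c'),c')=0$ for $c,c'\in\mathcal C_{\mathrm{inf}}$ with $\epsilon(c,c')\in\{0,1\}$.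
   Context: $\overline{[n]}=\{1<\dots<n<\overline n<\dots<\overline1\}$, $\overline{\overline k}=k$, $\chi$ = truth value in $\{0,1\}$. $\mathcal B=\{\emptyset\}\sqcup\{(x,y):x\le y\in\overline{[n]}\}$ with $H(\emptyset\otimes\emptyset)=0$, $H(\emptyset\otimes(x,y))=H((x,y)\otimes\emptyset)=1$, $H((x,y)\otimes(x',y'))=\chi(x\ge x')+\chi(y\ge y')-\chi(y\ge y'>x\ge x')$ if $\overline{y'}\ne x$, $=\chi(x>x')+\chi(y>y')-\chi(y>y'>x>x')$ if $\overline{y'}=x$. Colours $\mathcal C=\{c_b:b\in\mathcal B\}$ with $c_{x,y}:=c_{(x,y)}$; $\mathcal C_{\mathrm{free}}=\{c_\emptyset\}\cup\{c_{x,\overline x}:1\le x\le n\}$, $\mathcal C_{\mathrm{sup}}=\{c_{x,y}:\overline y<x\le y\}$, $\mathcal C_{\mathrm{inf}}=\{c_{x,y}:x\le y<\overline x\}$; $c_\infty\notin\mathcal C$. $\epsilon$ on $\mathcal C\times(\mathcal C\sqcup\{c_\infty\})$ is given by $\epsilon(c_{b'},c_b)=H(b\otimes b')$ for $b,b'\in\mathcal B$, and $\epsilon(\cdot,c_\infty)$ takes any values with $\epsilon(f,c_\infty)=1$ for $f\in\mathcal C_{\mathrm{free}}$, $\epsilon(c,c_\infty)\in\{1,2\}$ for $c\in\mathcal C_{\mathrm{inf}}$, $\epsilon(c,c_\infty)\in\{0,1\}$ for $c\in\mathcal C_{\mathrm{sup}}$. $\delta(c_{x,y})=c_{\overline y,y}$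 for $c_{x,y}\in\mathcal C_{\mathrm{sup}}$, $\delta(c_{x,y})=c_{x,\overline x}$ for $c_{x,y}\in\mathcal C_{\mathrm{inf}}$. $\gamma(c_{x,y},c_{x',y'})=c_{z,\overline z}$ with $z=\max\{x',\overline y\}$ for $(c_{x,y},c_{x',y'})\in\mathcal C_{\mathrm{sup}}\times\mathcal C_{\mathrm{inf}}$ with $\epsilon=0$; $=c_{\overline y,y}$ for pairs in $\mathcal C_{\mathrm{sup}}^2$ with $\epsilon\in\{0,1\}$; $=c_{x',\overline{x'}}$ for pairs in $\mathcal C_{\mathrm{inf}}^2$ with $\epsilon\in\{0,1\}$. Well-definedness conditions: (1) $\epsilon(c,c')=\chi(c\ne c')$ for $c,c'\in\mathcal C_{\mathrm{free}}$; (2) for $(c,c')\in\mathcal C_{\mathrm{sup}}\times\mathcal C_{\mathrm{free}}$: $\epsilon(c,c')\in\{0,1\}$, $\epsilon(c',c)\in\{1,2\}$, and every $c\in\mathcal C_{\mathrm{sup}}$ has $f\in\mathcal C_{\mathrm{free}}$ with $\epsilon(c,f)=0$; (3) for $(c,c')\in\mathcal C_{\mathrm{free}}\times\mathcal C_{\mathrm{inf}}$: $\epsilon(c,c')\in\{0,1\}$, $\epsilon(c',c)\in\{1,2\}$, and every $c\in\mathcal C_{\mathrm{inf}}$ has $f\in\mathcal C_{\mathrm{free}}$ with $\epsilon(f,c)=0$; (4) for $(c,c')\in\mathcal C_{\mathrm{sup}}\times\mathcal C_{\mathrm{inf}}$: $\epsilon(c,c')\in\{0,1\}$, $\epsilon(c',c)\in\{1,2\}$,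 and if $\epsilon(c,c')=0$ some $f\in\mathcal C_{\mathrm{free}}$ has $\epsilon(c,f)=\epsilon(f,c')=0$; (5) for $c,c'\in\mathcal C_{\mathrm{sup}}$ with $\epsilon(c,c')\in\{0,1\}$ some $f\in\mathcal C_{\mathrm{free}}$ has $\epsilon(c,f)=0$, $\epsilon(f,c')=1$; (6) for $c,c'\in\mathcal C_{\mathrm{inf}}$ with $\epsilon(c,c')\in\{0,1\}$ some $f\in\mathcal C_{\mathrm{free}}$ has $\epsilon(c,f)=1$, $\epsilon(f,c')=0$; (7) the stated conditions on $\epsilon(\cdot,c_\infty)$. -}

module Defs where

open import Data.Nat using (ℕ; _+_; _∸_)
open import Data.Fin using (Fin; _≤_; _<_; _≤?_; _<?_)
open import Data.Fin.Properties using (_≟_)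
open import Data.Bool using (if_then_else_; true; false)
open import Data.Product using (_×_; Σ; _,_)
open import Data.Sum using (_⊎_)
open import Data.Unit using (⊤; tt)
open import Data.Empty using (⊥)
open import Relation.Nullary using (Dec; yes; no; does; ¬_)
open import Relation.Nullary.Decidable using (_×-dec_)
open import Relation.Binary.PropositionalEquality using (_≡_; refl; sym; subst)

-- The alphabet  [n]‾ = {1 < … < n < n‾ < … < 1‾}.
-- ub i  is the letter i+1  (i : Fin n),  br i  is the letter  ‾(i+1).

data Letter (n : ℕ) : Set where
  ub : Fin n → Letter n
  br : Fin n → Letter n

bar : {n : ℕ} → Letter n → Letter n
bar (ub i) = br i
bar (br i) = ub i

data _≤L_ {n : ℕ} : Letter n → Letter n → Set where
  ub≤ub : {i j : Fin n} → i ≤ j → ub i ≤L ub j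
  ub≤br : {i j : Fin n} → ub i ≤L br j
  br≤br : {i j : Fin n} → j ≤ i → br i ≤L br j

data _<L_ {n : ℕ} : Letter n → Letter n → Set where
  ub<ub : {i j : Fin n} → i < j → ub i <L ub j
  ub<br : {i j : Fin n} → ub i <L br j
  br<br : {i j : Fin n} → j < i → br i <L br j

_≤L?_ : {n : ℕ} (a b : Letter n) → Dec (a ≤L b)
ub i ≤L? ub j with i ≤? j
... | yes p = yes (ub≤ub p)
... | no ¬p = no λ { (ub≤ub p) → ¬p p }
ub i ≤L? br j = yes ub≤br
br i ≤L? ub j = no λ ()
br i ≤L? br j with j ≤? i
... | yes p = yes (br≤br p)
... | no ¬p = no λ { (br≤br p) → ¬p p }

_<L?_ : {n : ℕ} (a b : Letter n) → Dec (a <L b)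
ub i <L? ub j with i <? j
... | yes p = yes (ub<ub p)
... | no ¬p = no λ { (ub<ub p) → ¬p p }
ub i <L? br j = yes ub<br
br i <L? ub j = no λ ()
br i <L? br j with j <? i
... | yes p = yes (br<br p)
... | no ¬p = no λ { (br<br p) → ¬p p }

_≟L_ : {n : ℕ} (a b : Letter n) → Dec (a ≡ b)
ub i ≟L ub j with i ≟ j
... | yes refl = yes refl
... | no ¬p = no λ { refl → ¬p refl }
ub i ≟L br j = no λ ()
br i ≟L ub j = no λ ()
br i ≟L br j with i ≟ j
... | yes refl = yes refl
... | no ¬p = no λ { refl → ¬p refl }

Unbarred : {n : ℕ} → Letter n → Set
Unbarred (ub _) = ⊤
Unbarred (br _) = ⊥

χ : {P : Set} → Dec P → ℕ
χ d = if does d then 1 else 0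

-- The set ℬ = {∅} ⊔ {(x,y) : x ≤ y}; the colour set 𝒞 = {c_b : b ∈ ℬ}
-- is identified with ℬ (c_b is written as b itself).

data Col (n : ℕ) : Set where
  ∅  : Col n
  cp : (x y : Letter n) → .(x ≤L y) → Col n

data Col∞ (n : ℕ) : Set where
  col : Col n → Col∞ n
  c∞  : Col∞ n

H : {n : ℕ} → Col n → Col n → ℕ
H ∅ ∅ = 0
H ∅ (cp _ _ _) = 1
H (cp _ _ _) ∅ = 1
H (cp x y _) (cp x' y' _) with bar y' ≟L x
... | no _  = χ (x' ≤L? x) + χ (y' ≤L? y) ∸ χ ((y' ≤L? y) ×-dec ((x <L? y') ×-dec (x' ≤L? x)))
... | yes _ = χ (x' <L? x) + χ (y' <L? y) ∸ χ ((y' <L? y) ×-dec ((x <L? y') ×-dec (x' <L? x)))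

ε : {n : ℕ} → (Col n → ℕ) → Col n → Col∞ n → ℕ
ε e∞ c' (col c) = H c c'
ε e∞ c' c∞      = e∞ c'

IsFree : {n : ℕ} → Col n → Set
IsFree ∅          = ⊤
IsFree (cp x y _) = (y ≡ bar x) × Unbarred x

IsSup : {n : ℕ} → Col n → Set
IsSup ∅          = ⊥
IsSup (cp x y _) = bar y <L x

IsInf : {n : ℕ} → Col n → Set
IsInf ∅          = ⊥
IsInf (cp x y _) = y <L bar x

private
  ub≤bar : {n : ℕ} (z : Letter n) → Unbarred z → z ≤L bar z
  ub≤bar (ub i) _ = ub≤br

  sup-ub : {n : ℕ} {x y : Letter n} → x ≤L y → bar y <L x → Unbarred (bar y)
  sup-ub {y = br j} _ _ = tt
  sup-ub {y = ub j} (ub≤ub _) ()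

  inf-ub : {n : ℕ} {x y : Letter n} → x ≤L y → y <L bar x → Unbarred x
  inf-ub {x = ub i} _ _ = tt
  inf-ub {x = br i} (br≤br _) ()

  sup-≤ : {n : ℕ} {x y : Letter n} → x ≤L y → bar y <L x → bar y ≤L y
  sup-≤ le p = subst (λ w → bar _ ≤L w) (bar-bar _) (ub≤bar _ (sup-ub le p))
    where
      bar-bar : {n : ℕ} (w : Letter n) → bar (bar w) ≡ w
      bar-bar (ub _) = refl
      bar-bar (br _) = refl

  inf-≤ : {n : ℕ} {x y : Letter n} → x ≤L y → y <L bar x → x ≤L bar x
  inf-≤ le p = ub≤bar _ (inf-ub le p)

maxL : {n : ℕ} → Letter n → Letter n → Letter n
maxL a b = if does (a ≤L? b) then b else a

private
  max-ub : {n : ℕ} (a b : Letter n) → Unbarred a → Unbarred b → Unbarred (maxL a b)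
  max-ub a b ua ub′ with does (a ≤L? b)
  ... | true  = ub′
  ... | false = ua

δsup : {n : ℕ} (c : Col n) → IsSup c → Col n
δsup (cp x y le) p = cp (bar y) y (sup-≤ le p)

δinf : {n : ℕ} (c : Col n) → IsInf c → Col n
δinf (cp x y le) p = cp x (bar x) (inf-≤ le p)

γsupinf : {n : ℕ} (c c' : Col n) → IsSup c → IsInf c' → Col n
γsupinf (cp x y le) (cp x' y' le') ps pi =
  cp (maxL x' (bar y)) (bar (maxL x' (bar y)))
     (ub≤bar _ (max-ub x' (bar y) (inf-ub le' pi) (sup-ub le ps)))

γsupsup : {n : ℕ} (c c' : Col n) → IsSup c → IsSup c' → Col n
γsupsup c c' ps ps' = δsup c ps

γinfinf : {n : ℕ} (c c' : Col n) → IsInf c → IsInf c' → Col n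
γinfinf c c' pi pi' = δinf c' pi'

In01 : ℕ → Set
In01 k = k ≡ 0 ⊎ k ≡ 1

In12 : ℕ → Set
In12 k = k ≡ 1 ⊎ k ≡ 2

WellDefined : (n : ℕ) → (Col n → Col∞ n → ℕ) → Set
WellDefined n e =
  ((c c' : Col n) → IsFree c → IsFree c' →
     (c ≡ c' → e c (col c') ≡ 0) × (¬ c ≡ c' → e c (col c') ≡ 1))
  × ((c c' : Col n) → IsSup c → IsFree c' →
       In01 (e c (col c')) × In12 (e c' (col c)))
  × ((c : Col n) → IsSup c → Σ (Col n) λ f → IsFree f × e c (col f) ≡ 0)
  × ((c c' : Col n) → IsFree c → IsInf c' →
       In01 (e c (col c')) × In12 (e c' (col c)))
  × ((c : Col n) → IsInf c → Σ (Col n) λ f → IsFree f × e f (col c) ≡ 0)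
  × ((c c' : Col n) → IsSup c → IsInf c' →
       In01 (e c (col c')) × In12 (e c' (col c))
       × (e c (col c') ≡ 0 →
            Σ (Col n) λ f → IsFree f × e c (col f) ≡ 0 × e f (col c') ≡ 0))
  × ((c c' : Col n) → IsSup c → IsSup c' → In01 (e c (col c')) →
       Σ (Col n) λ f → IsFree f × e c (col f) ≡ 0 × e f (col c') ≡ 1)
  × ((c c' : Col n) → IsInf c → IsInf c' → In01 (e c (col c')) →
       Σ (Col n) λ f → IsFree f × e c (col f) ≡ 1 × e f (col c') ≡ 0)
  × ((c : Col n) → IsFree c → e c c∞ ≡ 1)
  × ((c : Col n) → IsInf c → In12 (e c c∞))
  × ((c : Col n) → IsSup c → In01 (e c c∞))

Admissible∞ : {n : ℕ} → (Col n → ℕ) → Set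
Admissible∞ {n} e∞ =
  ((c : Col n) → IsFree c → e∞ c ≡ 1)
  × ((c : Col n) → IsInf c → In12 (e∞ c))
  × ((c : Col n) → IsSup c → In01 (e∞ c))

Witnesses : (n : ℕ) → (Col n → Col∞ n → ℕ) → Set
Witnesses n e =
  ((c : Col n) (p : IsSup c) → IsFree (δsup c p) × e c (col (δsup c p)) ≡ 0)
  × ((c : Col n) (p : IsInf c) → IsFree (δinf c p) × e (δinf c p) (col c) ≡ 0)
  × ((c c' : Col n) (p : IsSup c) (p' : IsInf c') → e c (col c') ≡ 0 →
       IsFree (γsupinf c c' p p')
       × e c (col (γsupinf c c' p p')) ≡ 0 × e (γsupinf c c' p p') (col c') ≡ 0)
  × ((c c' : Col n) (p : IsSup c) (p' : IsSup c') → In01 (e c (col c')) →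
       IsFree (γsupsup c c' p p')
       × e c (col (γsupsup c c' p p')) ≡ 0 × e (γsupsup c c' p p') (col c') ≡ 1)
  × ((c c' : Col n) (p : IsInf c) (p' : IsInf c') → In01 (e c (col c')) →
       IsFree (γinfinf c c' p p')
       × e c (col (γinfinf c c' p p')) ≡ 1 × e (γinfinf c c' p p') (col c') ≡ 0)

{-# OPTIONS --safe #-}
module Submission where

open import Defs
open import Data.Nat using (ℕ; _≤_; _+_; _∸_)
import Data.Nat.Properties as ℕ
import Data.Fin.Properties as Fin
open import Data.Bool using (Bool; true; false; _∧_; if_then_else_)
open import Data.Product using (_×_; _,_; proj₁; proj₂)
open import Data.Sum using (_⊎_; inj₁; inj₂)
open import Data.Unit using (tt)
open import Relation.Nullary using (Dec; yes; no; does; ¬_; contradiction)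
open import Relation.Nullary.Decidable using (dec-true; dec-false; recompute)
open import Relation.Binary.PropositionalEquality
  using (_≡_; _≢_; refl; sym; trans; cong; subst)

-- Every condition reduces to the truth values of the comparisons x' ⊑ x and
-- y' ⊑ y inside H((x,y) ⊗ (x',y')), where ⊑ is strict exactly when ȳ' = x:
-- H vanishes iff both fail, lies in {0,1} unless both hold while y' ≤ x, and
-- lies in {1,2} as soon as one holds.
-- The defining inequalities ȳ < x of 𝒞_sup and y < x̄ of 𝒞_inf, transported
-- through the order-reversing involution bar, decide these comparisons; the
-- witnesses δ and γ are the free colours whose entries sit on the right side
-- of both.

module _ {n : ℕ} where

  ≤L-refl : {a : Letter n} → a ≤L a
  ≤L-refl {ub _} = ub≤ub ℕ.≤-refl
  ≤L-refl {br _} = br≤br ℕ.≤-refl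

  ≤L-reflexive : {a b : Letter n} → a ≡ b → a ≤L b
  ≤L-reflexive refl = ≤L-refl

  ≤L-trans : {a b c : Letter n} → a ≤L b → b ≤L c → a ≤L c
  ≤L-trans (ub≤ub p) (ub≤ub q) = ub≤ub (ℕ.≤-trans p q)
  ≤L-trans (ub≤ub _) ub≤br     = ub≤br
  ≤L-trans ub≤br     (br≤br _) = ub≤br
  ≤L-trans (br≤br p) (br≤br q) = br≤br (ℕ.≤-trans q p)

  ≤L-antisym : {a b : Letter n} → a ≤L b → b ≤L a → a ≡ b
  ≤L-antisym (ub≤ub p) (ub≤ub q) = cong ub (Fin.≤-antisym p q)
  ≤L-antisym (br≤br p) (br≤br q) = cong br (Fin.≤-antisym q p)

  <L⇒≤L : {a b : Letter n} → a <L b → a ≤L b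
  <L⇒≤L (ub<ub p) = ub≤ub (ℕ.<⇒≤ p)
  <L⇒≤L ub<br     = ub≤br
  <L⇒≤L (br<br p) = br≤br (ℕ.<⇒≤ p)

  <L-≤L-trans : {a b c : Letter n} → a <L b → b ≤L c → a <L c
  <L-≤L-trans (ub<ub p) (ub≤ub q) = ub<ub (ℕ.<-≤-trans p q)
  <L-≤L-trans (ub<ub _) ub≤br     = ub<br
  <L-≤L-trans ub<br     (br≤br _) = ub<br
  <L-≤L-trans (br<br p) (br≤br q) = br<br (ℕ.≤-<-trans q p)

  ≤L-<L-trans : {a b c : Letter n} → a ≤L b → b <L c → a <L c
  ≤L-<L-trans (ub≤ub p) (ub<ub q) = ub<ub (ℕ.≤-<-trans p q)
  ≤L-<L-trans (ub≤ub _) ub<br     = ub<br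
  ≤L-<L-trans ub≤br     (br<br _) = ub<br
  ≤L-<L-trans (br≤br p) (br<br q) = br<br (ℕ.<-≤-trans q p)

  <L-irrefl : {a : Letter n} → ¬ a <L a
  <L-irrefl (ub<ub p) = ℕ.<-irrefl refl p
  <L-irrefl (br<br p) = ℕ.<-irrefl refl p

  <L⇒≢ : {a b : Letter n} → a <L b → a ≢ b
  <L⇒≢ p refl = <L-irrefl p

  ≤L⇒≯L : {a b : Letter n} → a ≤L b → ¬ b <L a
  ≤L⇒≯L p q = <L-irrefl (≤L-<L-trans p q)

  ≮L⇒≥L : {a b : Letter n} → ¬ a <L b → b ≤L a
  ≮L⇒≥L {ub _} {ub _} h = ub≤ub (ℕ.≮⇒≥ λ p → h (ub<ub p))
  ≮L⇒≥L {ub _} {br _} h = contradiction ub<br h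
  ≮L⇒≥L {br _} {ub _} h = ub≤br
  ≮L⇒≥L {br _} {br _} h = br≤br (ℕ.≮⇒≥ λ p → h (br<br p))

  ≰L⇒>L : {a b : Letter n} → ¬ a ≤L b → b <L a
  ≰L⇒>L {ub _} {ub _} h = ub<ub (ℕ.≰⇒> λ p → h (ub≤ub p))
  ≰L⇒>L {ub _} {br _} h = contradiction ub≤br h
  ≰L⇒>L {br _} {ub _} h = ub<br
  ≰L⇒>L {br _} {br _} h = br<br (ℕ.≰⇒> λ p → h (br≤br p))

  <L-or-≥L : (a b : Letter n) → a <L b ⊎ b ≤L a
  <L-or-≥L a b with a <L? b
  ... | yes a<b = inj₁ a<b
  ... | no  a≮b = inj₂ (≮L⇒≥L a≮b)

  ≤L∧≢⇒<L : {a b : Letter n} → a ≤L b → a ≢ b → a <L b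
  ≤L∧≢⇒<L {a} {b} a≤b a≢b with <L-or-≥L a b
  ... | inj₁ a<b = a<b
  ... | inj₂ b≤a = contradiction (≤L-antisym a≤b b≤a) a≢b

  bar-involutive : (a : Letter n) → bar (bar a) ≡ a
  bar-involutive (ub _) = refl
  bar-involutive (br _) = refl

  bar-antitone-≤ : {a b : Letter n} → a ≤L b → bar b ≤L bar a
  bar-antitone-≤ (ub≤ub p) = br≤br p
  bar-antitone-≤ ub≤br     = ub≤br
  bar-antitone-≤ (br≤br p) = ub≤ub p

  bar-antitone-< : {a b : Letter n} → a <L b → bar b <L bar a
  bar-antitone-< (ub<ub p) = br<br p
  bar-antitone-< ub<br     = ub<br
  bar-antitone-< (br<br p) = ub<ub p

  ≤bar⇒≤bar : {a b : Letter n} → a ≤L bar b → b ≤L bar a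
  ≤bar⇒≤bar {a} {b} p = subst (_≤L bar a) (bar-involutive b) (bar-antitone-≤ p)

  <bar⇒<bar : {a b : Letter n} → a <L bar b → b <L bar a
  <bar⇒<bar {a} {b} p = subst (_<L bar a) (bar-involutive b) (bar-antitone-< p)

  bar<⇒bar< : {a b : Letter n} → bar a <L b → bar b <L a
  bar<⇒bar< {a} {b} p = subst (bar b <L_) (bar-involutive a) (bar-antitone-< p)

  <bar⇒unbarred : {a : Letter n} → a <L bar a → Unbarred a
  <bar⇒unbarred {ub _} _ = tt

does-true⇒ : {P : Set} (d : Dec P) → does d ≡ true → P
does-true⇒ (yes p) _ = p

does-false⇒ : {P : Set} (d : Dec P) → does d ≡ false → ¬ P
does-false⇒ (no ¬p) _ = ¬p

χᵇ : Bool → ℕ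
χᵇ b = if b then 1 else 0

energy : Bool → Bool → Bool → ℕ
energy p q m = χᵇ p + χᵇ q ∸ χᵇ (q ∧ (m ∧ p))

energy-In01 : (p q m : Bool) → (p ≡ true → q ≡ true → m ≡ true) → In01 (energy p q m)
energy-In01 false false _     _ = inj₁ refl
energy-In01 false true  true  _ = inj₂ refl
energy-In01 false true  false _ = inj₂ refl
energy-In01 true  false _     _ = inj₂ refl
energy-In01 true  true  true  _ = inj₂ refl
energy-In01 true  true  false h with h refl refl
... | ()

energy-In12 : (p q m : Bool) → p ≡ true ⊎ q ≡ true → In12 (energy p q m)
energy-In12 false false _     (inj₁ ())
energy-In12 false false _     (inj₂ ())
energy-In12 false true  true  _ = inj₁ refl
energy-In12 false true  false _ = inj₁ refl
energy-In12 true  false _     _ = inj₁ refl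
energy-In12 true  true  true  _ = inj₁ refl
energy-In12 true  true  false _ = inj₂ refl

energy≡0⇒ : (p q m : Bool) → energy p q m ≡ 0 → p ≡ false × q ≡ false
energy≡0⇒ false false _     _  = refl , refl
energy≡0⇒ false true  true  ()
energy≡0⇒ false true  false ()
energy≡0⇒ true  false true  ()
energy≡0⇒ true  false false ()
energy≡0⇒ true  true  true  ()
energy≡0⇒ true  true  false ()

In01∧In12⇒≡1 : {k : ℕ} → In01 k → In12 k → k ≡ 1
In01∧In12⇒≡1 (inj₁ refl) (inj₁ ())
In01∧In12⇒≡1 (inj₁ refl) (inj₂ ())
In01∧In12⇒≡1 (inj₂ refl) _ = refl

In01⇒≢2 : {k : ℕ} → In01 k → k ≢ 2
In01⇒≢2 (inj₁ refl) ()
In01⇒≢2 (inj₂ refl) ()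

module _ {n : ℕ} where

  _≼[_]_ : Letter n → Bool → Letter n → Bool
  a ≼[ true  ] b = does (a <L? b)
  a ≼[ false ] b = does (a ≤L? b)

  ≼-true⇒≤L : {a b : Letter n} (s : Bool) → a ≼[ s ] b ≡ true → a ≤L b
  ≼-true⇒≤L {a} {b} true  h = <L⇒≤L (does-true⇒ (a <L? b) h)
  ≼-true⇒≤L {a} {b} false h = does-true⇒ (a ≤L? b) h

  ≼-false⇒≥L : {a b : Letter n} (s : Bool) → a ≼[ s ] b ≡ false → b ≤L a
  ≼-false⇒≥L {a} {b} true  h = ≮L⇒≥L (does-false⇒ (a <L? b) h)
  ≼-false⇒≥L {a} {b} false h = <L⇒≤L (≰L⇒>L (does-false⇒ (a ≤L? b) h))

  <L⇒≼-true : {a b : Letter n} (s : Bool) → a <L b → a ≼[ s ] b ≡ true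
  <L⇒≼-true {a} {b} true  a<b = dec-true (a <L? b) a<b
  <L⇒≼-true {a} {b} false a<b = dec-true (a ≤L? b) (<L⇒≤L a<b)

  >L⇒≼-false : {a b : Letter n} (s : Bool) → b <L a → a ≼[ s ] b ≡ false
  >L⇒≼-false {a} {b} true  b<a = dec-false (a <L? b) (≤L⇒≯L (<L⇒≤L b<a))
  >L⇒≼-false {a} {b} false b<a = dec-false (a ≤L? b) (λ a≤b → ≤L⇒≯L a≤b b<a)

module _ {n : ℕ} {x y x' y' : Letter n} .{u : x ≤L y} .{v : x' ≤L y'} where

  private
    s : Bool
    s = does (bar y' ≟L x)

  H-cp : H (cp x y u) (cp x' y' v) ≡ energy (x' ≼[ s ] x) (y' ≼[ s ] y) (does (x <L? y'))
  H-cp with bar y' ≟L x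
  ... | yes _ = refl
  ... | no  _ = refl

  H-In01 : (x' ≤L x → y' ≤L y → x <L y') → In01 (H (cp x y u) (cp x' y' v))
  H-In01 h rewrite H-cp =
    energy-In01 _ _ _ λ p q → dec-true (x <L? y') (h (≼-true⇒≤L s p) (≼-true⇒≤L s q))

  H-In12 : x' <L x ⊎ y' <L y → In12 (H (cp x y u) (cp x' y' v))
  H-In12 h rewrite H-cp = energy-In12 _ _ _ (comparison-holds h)
    where
      comparison-holds : x' <L x ⊎ y' <L y → x' ≼[ s ] x ≡ true ⊎ y' ≼[ s ] y ≡ true
      comparison-holds (inj₁ x'<x) = inj₁ (<L⇒≼-true s x'<x)
      comparison-holds (inj₂ y'<y) = inj₂ (<L⇒≼-true s y'<y)

  H≡0⇒≤L : H (cp x y u) (cp x' y' v) ≡ 0 → x ≤L x' × y ≤L y'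
  H≡0⇒≤L h rewrite H-cp with energy≡0⇒ _ _ _ h
  ... | p , q = ≼-false⇒≥L s p , ≼-false⇒≥L s q

  H-<L≡0 : x <L x' → y <L y' → H (cp x y u) (cp x' y' v) ≡ 0
  H-<L≡0 x<x' y<y' rewrite H-cp
                         | >L⇒≼-false s x<x' | >L⇒≼-false s y<y' = refl

  H-bar≡-≤L≡0 : bar y' ≡ x → x ≤L x' → y ≤L y' → H (cp x y u) (cp x' y' v) ≡ 0
  H-bar≡-≤L≡0 e x≤x' y≤y' rewrite H-cp | dec-true (bar y' ≟L x) e
                                | dec-false (x' <L? x) (≤L⇒≯L x≤x')
                                | dec-false (y' <L? y) (≤L⇒≯L y≤y') = refl

  H-bar≢≡0⇒<L : bar y' ≢ x → H (cp x y u) (cp x' y' v) ≡ 0 → x <L x' × y <L y'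
  H-bar≢≡0⇒<L ne h rewrite H-cp | dec-false (bar y' ≟L x) ne
    with energy≡0⇒ _ _ _ h
  ... | p , q = ≰L⇒>L (does-false⇒ (x' ≤L? x) p) , ≰L⇒>L (does-false⇒ (y' ≤L? y) q)

  H-bar≢-≥L≡2 : bar y' ≢ x → x' ≤L x → y' ≤L y → y' ≤L x →
                H (cp x y u) (cp x' y' v) ≡ 2
  H-bar≢-≥L≡2 ne x'≤x y'≤y y'≤x rewrite H-cp | dec-false (bar y' ≟L x) ne
                                      | dec-true (x' ≤L? x) x'≤x | dec-true (y' ≤L? y) y'≤y
                                      | dec-false (x <L? y') (≤L⇒≯L y'≤x) = refl

module _ {n : ℕ} where

  private
    recover : {a b : Letter n} → .(a ≤L b) → a ≤L b
    recover {a} {b} = recompute (a ≤L? b)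

  H-free-free : (f f' : Col n) → IsFree f → IsFree f' →
                (f ≡ f' → H f' f ≡ 0) × (f ≢ f' → H f' f ≡ 1)
  H-free-free ∅ ∅ _ _ = (λ _ → refl) , (λ ne → contradiction refl ne)
  H-free-free ∅ (cp _ _ _) _ _ = (λ ()) , (λ _ → refl)
  H-free-free (cp _ _ _) ∅ _ _ = (λ ()) , (λ _ → refl)
  H-free-free (cp a _ _) (cp b _ _) (refl , _) (refl , _) with a ≟L b
  ... | yes refl = (λ _ → H-bar≡-≤L≡0 (bar-involutive a) ≤L-refl ≤L-refl)
                 , (λ ne → contradiction refl ne)
  ... | no a≢b = (λ { refl → contradiction refl a≢b })
               , (λ _ → In01∧In12⇒≡1 (H-In01 not-both) (H-In12 one))
    where
      not-both : a ≤L b → bar a ≤L bar b → b <L bar a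
      not-both a≤b ā≤b̄ =
        contradiction (≤L-antisym a≤b (unbar (bar-antitone-≤ ā≤b̄))) a≢b
        where
          unbar : bar (bar b) ≤L bar (bar a) → b ≤L a
          unbar p rewrite bar-involutive a | bar-involutive b = p
      one : a <L b ⊎ bar a <L bar b
      one with <L-or-≥L a b
      ... | inj₁ a<b = inj₁ a<b
      ... | inj₂ b≤a = inj₂ (bar-antitone-< (≤L∧≢⇒<L b≤a (λ e → a≢b (sym e))))

  sup-free-bounds : (c f : Col n) → IsSup c → IsFree f → In01 (H f c) × In12 (H c f)
  sup-free-bounds (cp x y _) ∅ _ _ = inj₂ refl , inj₁ refl
  sup-free-bounds (cp x y _) (cp a _ _) ȳ<x (refl , _) = H-In01 impossible , H-In12 one
    where
      impossible : x ≤L a → y ≤L bar a → a <L y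
      impossible x≤a y≤ā =
        contradiction (<L-≤L-trans ȳ<x (≤L-trans x≤a (≤bar⇒≤bar y≤ā))) <L-irrefl
      one : a <L x ⊎ bar a <L y
      one with <L-or-≥L a x
      ... | inj₁ a<x = inj₁ a<x
      ... | inj₂ x≤a = inj₂ (≤L-<L-trans (bar-antitone-≤ x≤a) (bar<⇒bar< ȳ<x))

  free-inf-bounds : (f c : Col n) → IsFree f → IsInf c → In01 (H c f) × In12 (H f c)
  free-inf-bounds ∅ (cp x y _) _ _ = inj₂ refl , inj₁ refl
  free-inf-bounds (cp a _ _) (cp x y _) (refl , _) y<x̄ = H-In01 impossible , H-In12 one
    where
      impossible : a ≤L x → bar a ≤L y → x <L bar a
      impossible a≤x ā≤y =
        contradiction (≤L-<L-trans ā≤y (<L-≤L-trans y<x̄ (bar-antitone-≤ a≤x))) <L-irrefl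
      one : x <L a ⊎ y <L bar a
      one with <L-or-≥L x a
      ... | inj₁ x<a = inj₁ x<a
      ... | inj₂ a≤x = inj₂ (<L-≤L-trans y<x̄ (bar-antitone-≤ a≤x))

  sup-inf-bounds : (c c' : Col n) → IsSup c → IsInf c' → In01 (H c' c) × In12 (H c c')
  sup-inf-bounds (cp x y _) (cp x' y' _) ȳ<x y'<x̄' = H-In01 impossible , H-In12 one
    where
      impossible : x ≤L x' → y ≤L y' → x' <L y
      impossible x≤x' y≤y' =
        contradiction (<L-≤L-trans (<L-≤L-trans ȳ<x x≤x')
                                   (<L⇒≤L (<bar⇒<bar (≤L-<L-trans y≤y' y'<x̄'))))
                      <L-irrefl
      one : x' <L x ⊎ y' <L y
      one with <L-or-≥L x' x
      ... | inj₁ x'<x = inj₁ x'<x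
      ... | inj₂ x≤x' =
        inj₂ (<L-≤L-trans y'<x̄' (≤L-trans (bar-antitone-≤ x≤x') (<L⇒≤L (bar<⇒bar< ȳ<x))))

  δsup-witness : (c : Col n) (p : IsSup c) → IsFree (δsup c p) × H (δsup c p) c ≡ 0
  δsup-witness (cp x y x≤y) ȳ<x =
    (sym (bar-involutive y) , <bar⇒unbarred ȳ<ȳ̄)
    , H-bar≡-≤L≡0 refl (<L⇒≤L ȳ<x) ≤L-refl
    where
      ȳ<ȳ̄ : bar y <L bar (bar y)
      ȳ<ȳ̄ = <L-≤L-trans ȳ<x (≤L-trans (recover x≤y) (≤L-reflexive (sym (bar-involutive y))))

  δinf-witness : (c : Col n) (p : IsInf c) → IsFree (δinf c p) × H c (δinf c p) ≡ 0
  δinf-witness (cp x y x≤y) y<x̄ =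
    (refl , <bar⇒unbarred (≤L-<L-trans (recover x≤y) y<x̄))
    , H-bar≡-≤L≡0 (bar-involutive x) ≤L-refl (<L⇒≤L y<x̄)

  γsupinf-witness : (c c' : Col n) (p : IsSup c) (p' : IsInf c') → H c' c ≡ 0 →
                    IsFree (γsupinf c c' p p')
                    × H (γsupinf c c' p p') c ≡ 0 × H c' (γsupinf c c' p p') ≡ 0
  γsupinf-witness (cp x y x≤y) (cp x' y' x'≤y') ȳ<x y'<x̄' h with x' ≤L? bar y
  ... | yes x'≤ȳ = (refl , proj₂ (proj₁ (δsup-witness (cp x y x≤y) ȳ<x)))
                 , H-bar≡-≤L≡0 refl (<L⇒≤L ȳ<x) (≤L-reflexive (bar-involutive y))
                 , right (bar y ≟L x')
    where
      right : Dec (bar y ≡ x') → H (cp x' y' x'≤y') (cp (bar y) (bar (bar y)) _) ≡ 0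
      right (yes ȳ≡x') = H-bar≡-≤L≡0 (trans (bar-involutive (bar y)) ȳ≡x') x'≤ȳ
                           (≤L-trans (proj₂ (H≡0⇒≤L h)) (≤L-reflexive (sym (bar-involutive y))))
      right (no ȳ≢x')  = H-<L≡0 (≤L∧≢⇒<L x'≤ȳ (λ e → ȳ≢x' (sym e)))
                           (<L-≤L-trans (proj₂ (H-bar≢≡0⇒<L ȳ≢x' h))
                                        (≤L-reflexive (sym (bar-involutive y))))
  ... | no x'≰ȳ =
    let (free , vanish) = δinf-witness (cp x' y' x'≤y') y'<x̄'
    in free , H-<L≡0 (proj₁ (H-bar≢≡0⇒<L (<L⇒≢ ȳ<x') h)) (bar<⇒bar< ȳ<x') , vanish
    where
      ȳ<x' : bar y <L x'
      ȳ<x' = ≰L⇒>L x'≰ȳ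

  -- If y ≤ x' the pair ((x',y'),(x,y)) would have energy 2, against ε(c,c') ∈ {0,1}.
  γsupsup-witness : (c c' : Col n) (p : IsSup c) (p' : IsSup c') → In01 (H c' c) →
                    IsFree (γsupsup c c' p p')
                    × H (γsupsup c c' p p') c ≡ 0 × H c' (γsupsup c c' p p') ≡ 1
  γsupsup-witness (cp x y x≤y) (cp x' y' _) ȳ<x ȳ'<x' h =
    let (free , vanish) = δsup-witness (cp x y x≤y) ȳ<x
    in free , vanish , In01∧In12⇒≡1 (H-In01 x'<y) (H-In12 one)
    where
      one : bar y <L x' ⊎ y <L y'
      one with <L-or-≥L (bar y) x'
      ... | inj₁ ȳ<x' = inj₁ ȳ<x'
      ... | inj₂ x'≤ȳ = inj₂ (≤L-<L-trans (≤bar⇒≤bar x'≤ȳ) (bar<⇒bar< ȳ'<x'))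
      x'<y : bar y ≤L x' → y ≤L y' → x' <L y
      x'<y _ y≤y' with <L-or-≥L x' y
      ... | inj₁ x'<y = x'<y
      ... | inj₂ y≤x' = contradiction (H-bar≢-≥L≡2 ȳ≢x' x≤x' y≤y' y≤x') (In01⇒≢2 h)
        where
          x≤x' : x ≤L x'
          x≤x' = ≤L-trans (recover x≤y) y≤x'
          ȳ≢x' : bar y ≢ x'
          ȳ≢x' = <L⇒≢ (<L-≤L-trans ȳ<x x≤x')

  -- If y ≤ x' the pair ((x',y'),(x,y)) would have energy 2, against ε(c,c') ∈ {0,1}.
  γinfinf-witness : (c c' : Col n) (p : IsInf c) (p' : IsInf c') → In01 (H c' c) →
                    IsFree (γinfinf c c' p p')
                    × H (γinfinf c c' p p') c ≡ 1 × H c' (γinfinf c c' p p') ≡ 0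
  γinfinf-witness (cp x y _) (cp x' y' x'≤y') y<x̄ y'<x̄' h =
    let (free , vanish) = δinf-witness (cp x' y' x'≤y') y'<x̄'
    in free , In01∧In12⇒≡1 (H-In01 x'<y) (H-In12 one) , vanish
    where
      one : x <L x' ⊎ y <L bar x'
      one with <L-or-≥L x x'
      ... | inj₁ x<x' = inj₁ x<x'
      ... | inj₂ x'≤x = inj₂ (<L-≤L-trans y<x̄ (bar-antitone-≤ x'≤x))
      x'<y : x ≤L x' → y ≤L bar x' → x' <L y
      x'<y x≤x' _ with <L-or-≥L x' y
      ... | inj₁ x'<y = x'<y
      ... | inj₂ y≤x' = contradiction (H-bar≢-≥L≡2 ȳ≢x' x≤x' y≤y' y≤x') (In01⇒≢2 h)
        where
          y≤y' : y ≤L y'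
          y≤y' = ≤L-trans y≤x' (recover x'≤y')
          ȳ≢x' : bar y ≢ x'
          ȳ≢x' e = <L-irrefl (<L-≤L-trans (<bar⇒<bar (≤L-<L-trans y≤y' y'<x̄')) (≤L-reflexive e))

lemma3p10 : (n : ℕ) → 1 ≤ n → (e∞ : Col n → ℕ) → Admissible∞ e∞ →
    WellDefined n (ε e∞) × Witnesses n (ε e∞)
lemma3p10 n _ e∞ (free∞ , inf∞ , sup∞) =
  ( H-free-free
  , sup-free-bounds
  , (λ c p → δsup c p , δsup-witness c p)
  , free-inf-bounds
  , (λ c p → δinf c p , δinf-witness c p)
  , (λ c c' p p' → proj₁ (sup-inf-bounds c c' p p') , proj₂ (sup-inf-bounds c c' p p')
                 , λ h → γsupinf c c' p p' , γsupinf-witness c c' p p' h)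
  , (λ c c' p p' h → γsupsup c c' p p' , γsupsup-witness c c' p p' h)
  , (λ c c' p p' h → γinfinf c c' p p' , γinfinf-witness c c' p p' h)
  , free∞ , inf∞ , sup∞ )
  , ( δsup-witness , δinf-witness , γsupinf-witness , γsupsup-witness , γinfinf-witness )
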